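{- Let $p,q$ be positive integers and $\alpha,\beta$ integers with $0\le\alpha<p$ and $0\le\beta<q$. Define, for integers $k$, $$f(k)=\binom{p}{2}+\binom{q}{2}-\binom{k}{2}+\alpha q+k(2p-2\alpha-1)+|\beta-k|,$$ where $\binom{k}{2}=k(k-1)/2$. If $0\le k\le q$, then $f(k)\ge\min\{f(0),f(q)\}$. -}

module Defs where

open import Data.Nat as ℕ using (ℕ)
open import Data.Nat.Combinatorics using (_C_)
open import Data.Integer using (ℤ; +_; _+_; _-_; _*_; ∣_∣)

-- binom k 2 = k(k-1)/2 for natural k (the statement only evaluates f at 0 ≤ k ≤ q)
choose2 : ℕ → ℤ
choose2 k = + (k C 2)

f : (p q α β k : ℕ) → ℤ
f p q α β k =
  choose2 p + choose2 q - choose2 k + (+ α) * (+ q)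
  + (+ k) * ((+ 2) * (+ p) - (+ 2) * (+ α) - + 1)
  + + ∣ (+ β) - (+ k) ∣

-- Write c = 2p − 2α − 1 ∈ ℕ, so that f(k) = K − C(k,2) + ck + |β − k| for a constant K.
-- For k ≤ c compare with f(0): the term |β − k| loses at most k against |β − 0|, and
-- C(k,2) + k ≤ ck. For k > c compare with f(q): moving from k to q = k + d gains at most
-- d in |β − ·| and dc in the linear term, but C(·,2) grows by at least dk ≥ d(c + 1).
module Submission where

open import Defs
open import Data.Nat using (ℕ; zero; suc; _+_; _*_; _<_; _≤_; z≤n; ∣_-_∣; _≤?_)
open import Data.Nat.Properties
  using (+-comm; +-assoc; +-identityʳ; +-suc; <⇒≤; ≰⇒>; m≤m+n; +-monoˡ-≤; +-monoʳ-≤; +-mono-≤;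
         *-monoʳ-≤; ∣-∣-identityʳ; m≤n+∣m-n∣; ∣-∣-triangle; ∣m-m+n∣≡n; m≤n⇒∃[o]m+o≡n; module ≤-Reasoning)
open import Data.Nat.Combinatorics using (_C_; nCk+nC[k+1]≡[n+1]C[k+1]; nC1≡n)
open import Data.Nat.Tactic.RingSolver as ℕ-Solver using ()
open import Data.Integer as ℤ using (+_; _⊖_; _⊓_; +≤+) renaming (_≤_ to _≤ℤ_)
import Data.Integer.Properties as ℤ
open import Data.Integer.Tactic.RingSolver as ℤ-Solver using ()
open import Data.Product using (∃; _,_)
open import Relation.Binary.PropositionalEquality using (_≡_; refl; sym; trans; cong; subst₂; module ≡-Reasoning)
open import Relation.Nullary using (yes; no)

[1+n]C2 : ∀ n → suc n C 2 ≡ n C 2 + n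
[1+n]C2 n = trans (sym (nCk+nC[k+1]≡[n+1]C[k+1] n 1))
                (trans (cong (_+ n C 2) (nC1≡n n)) (+-comm n (n C 2)))

[m+n]C2 : ∀ m n → (m + n) C 2 ≡ m C 2 + n * m + n C 2
[m+n]C2 m zero = trans (cong (λ x → x C 2) (+-identityʳ m))
                       (sym (trans (+-identityʳ _) (+-identityʳ _)))
[m+n]C2 m (suc n) = begin
  (m + suc n) C 2                       ≡⟨ cong (λ x → x C 2) (+-suc m n) ⟩
  suc (m + n) C 2                       ≡⟨ [1+n]C2 (m + n) ⟩
  (m + n) C 2 + (m + n)                 ≡⟨ cong (_+ (m + n)) ([m+n]C2 m n) ⟩
  m C 2 + n * m + n C 2 + (m + n)       ≡⟨ regroup (m C 2) (n C 2) m n ⟩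
  m C 2 + suc n * m + (n C 2 + n)       ≡⟨ cong (λ x → m C 2 + suc n * m + x) ([1+n]C2 n) ⟨
  m C 2 + suc n * m + suc n C 2         ∎
  where
  open ≡-Reasoning
  regroup : ∀ a b m n → a + n * m + b + (m + n) ≡ a + suc n * m + (b + n)
  regroup = ℕ-Solver.solve-∀

nC2+n≤n*c : ∀ {n c} → n ≤ c → n C 2 + n ≤ n * c
nC2+n≤n*c {zero} _ = z≤n
nC2+n≤n*c {suc n} {c} n<c = begin
  suc n C 2 + suc n  ≡⟨ cong (_+ suc n) ([1+n]C2 n) ⟩
  n C 2 + n + suc n  ≤⟨ +-mono-≤ (nC2+n≤n*c (<⇒≤ n<c)) n<c ⟩
  n * c + c          ≡⟨ +-comm (n * c) c ⟩
  suc n * c          ∎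
  where open ≤-Reasoning

leftEnd-≤ : ∀ β {k c} → k ≤ c → k C 2 + ∣ β - 0 ∣ ≤ k * c + ∣ β - k ∣
leftEnd-≤ β {k} {c} k≤c = begin
  k C 2 + ∣ β - 0 ∣          ≡⟨ cong (_+_ (k C 2)) (∣-∣-identityʳ β) ⟩
  k C 2 + β                  ≤⟨ +-monoʳ-≤ (k C 2) (m≤n+∣m-n∣ β k) ⟩
  k C 2 + (k + ∣ β - k ∣)    ≡⟨ +-assoc (k C 2) k ∣ β - k ∣ ⟨
  k C 2 + k + ∣ β - k ∣      ≤⟨ +-monoˡ-≤ ∣ β - k ∣ (nC2+n≤n*c k≤c) ⟩
  k * c + ∣ β - k ∣          ∎
  where open ≤-Reasoning

rightEnd-≤ : ∀ β {k c} d → c < k →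
             k C 2 + ((k + d) * c + ∣ β - (k + d) ∣) ≤ (k + d) C 2 + (k * c + ∣ β - k ∣)
rightEnd-≤ β {k} {c} d c<k = begin
  k C 2 + ((k + d) * c + ∣ β - (k + d) ∣)
    ≤⟨ +-monoʳ-≤ (k C 2) (+-monoʳ-≤ ((k + d) * c) distance-growth) ⟩
  k C 2 + ((k + d) * c + (∣ β - k ∣ + d))
    ≡⟨ regroup (k C 2) k d c ∣ β - k ∣ ⟩
  k C 2 + d * suc c + (k * c + ∣ β - k ∣)
    ≤⟨ +-monoˡ-≤ (k * c + ∣ β - k ∣) (+-monoʳ-≤ (k C 2) (*-monoʳ-≤ d c<k)) ⟩
  k C 2 + d * k + (k * c + ∣ β - k ∣)
    ≤⟨ +-monoˡ-≤ (k * c + ∣ β - k ∣) (m≤m+n (k C 2 + d * k) (d C 2)) ⟩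
  k C 2 + d * k + d C 2 + (k * c + ∣ β - k ∣)
    ≡⟨ cong (_+ (k * c + ∣ β - k ∣)) ([m+n]C2 k d) ⟨
  (k + d) C 2 + (k * c + ∣ β - k ∣)
    ∎
  where
  open ≤-Reasoning
  distance-growth : ∣ β - (k + d) ∣ ≤ ∣ β - k ∣ + d
  distance-growth = begin
    ∣ β - (k + d) ∣                ≤⟨ ∣-∣-triangle β k (k + d) ⟩
    ∣ β - k ∣ + ∣ k - (k + d) ∣    ≡⟨ cong (_+_ ∣ β - k ∣) (∣m-m+n∣≡n k d) ⟩
    ∣ β - k ∣ + d                  ∎
  regroup : ∀ t k d c e → t + ((k + d) * c + (e + d)) ≡ t + d * suc c + (k * c + e)
  regroup = ℕ-Solver.solve-∀

∣m⊖n∣≡∣m-n∣ : ∀ m n → ℤ.∣ m ⊖ n ∣ ≡ ∣ m - n ∣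
∣m⊖n∣≡∣m-n∣ zero    zero    = refl
∣m⊖n∣≡∣m-n∣ zero    (suc n) = refl
∣m⊖n∣≡∣m-n∣ (suc m) zero    = refl
∣m⊖n∣≡∣m-n∣ (suc m) (suc n) = trans (cong ℤ.∣_∣ (ℤ.[1+m]⊖[1+n]≡m⊖n m n)) (∣m⊖n∣≡∣m-n∣ m n)

∣[+m]-[+n]∣≡∣m-n∣ : ∀ m n → ℤ.∣ + m ℤ.- + n ∣ ≡ ∣ m - n ∣
∣[+m]-[+n]∣≡∣m-n∣ m n = trans (cong ℤ.∣_∣ (ℤ.[+m]-[+n]≡m⊖n m n)) (∣m⊖n∣≡∣m-n∣ m n)

i-m+n≤i-o+p : ∀ i {m n o p} → o + n ≤ m + p → i ℤ.- + m ℤ.+ + n ≤ℤ i ℤ.- + o ℤ.+ + p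
i-m+n≤i-o+p i {m} {n} {o} {p} o+n≤m+p =
  subst₂ _≤ℤ_ (regroupˡ i (+ m) (+ n) (+ o)) (regroupʳ i (+ m) (+ o) (+ p))
    (ℤ.+-monoʳ-≤ (i ℤ.- + m ℤ.- + o) (+≤+ o+n≤m+p))
  where
  regroupˡ : ∀ i m n o → i ℤ.- m ℤ.- o ℤ.+ (o ℤ.+ n) ≡ i ℤ.- m ℤ.+ n
  regroupˡ = ℤ-Solver.solve-∀
  regroupʳ : ∀ i m o p → i ℤ.- m ℤ.- o ℤ.+ (m ℤ.+ p) ≡ i ℤ.- o ℤ.+ p
  regroupʳ = ℤ-Solver.solve-∀

slope-ℕ : ∀ {p α} → α < p → ∃ λ c → + 2 ℤ.* + p ℤ.- + 2 ℤ.* + α ℤ.- + 1 ≡ + c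
slope-ℕ {α = α} α<p with m≤n⇒∃[o]m+o≡n α<p
... | m , refl = suc (m + m) , expand (+ α) (+ m)
  where
  expand : ∀ a m → + 2 ℤ.* (+ 1 ℤ.+ a ℤ.+ m) ℤ.- + 2 ℤ.* a ℤ.- + 1 ≡ + 1 ℤ.+ (m ℤ.+ m)
  expand = ℤ-Solver.solve-∀

module _ (p q α β : ℕ) {c : ℕ} (slope≡c : + 2 ℤ.* + p ℤ.- + 2 ℤ.* + α ℤ.- + 1 ≡ + c) where

  f≡ : ∀ k → f p q α β k ≡
             choose2 p ℤ.+ choose2 q ℤ.+ + α ℤ.* + q ℤ.- + (k C 2) ℤ.+ + (k * c + ∣ β - k ∣)
  f≡ k rewrite slope≡c | sym (ℤ.pos-* k c) | ∣[+m]-[+n]∣≡∣m-n∣ β k =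
    regroup (choose2 p) (choose2 q) (+ α ℤ.* + q) (+ (k C 2)) (+ (k * c)) (+ ∣ β - k ∣)
    where
    regroup : ∀ a b e t l d → a ℤ.+ b ℤ.- t ℤ.+ e ℤ.+ l ℤ.+ d ≡ a ℤ.+ b ℤ.+ e ℤ.- t ℤ.+ (l ℤ.+ d)
    regroup = ℤ-Solver.solve-∀

  f-mono : ∀ a b → b C 2 + (a * c + ∣ β - a ∣) ≤ a C 2 + (b * c + ∣ β - b ∣) →
           f p q α β a ≤ℤ f p q α β b
  f-mono a b h = subst₂ _≤ℤ_ (sym (f≡ a)) (sym (f≡ b))
    (i-m+n≤i-o+p (choose2 p ℤ.+ choose2 q ℤ.+ + α ℤ.* + q) h)

proposition21 : (p q α β : ℕ) → 0 < p → 0 < q → α < p → β < q →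
    (k : ℕ) → k ≤ q →
    (f p q α β 0 ⊓ f p q α β q) ≤ℤ f p q α β k
proposition21 p q α β _ _ α<p _ k k≤q with slope-ℕ α<p
... | c , slope≡c with k ≤? c
... | yes k≤c = ℤ.≤-trans (ℤ.i⊓j≤i _ _) (f-mono p q α β slope≡c 0 k (leftEnd-≤ β k≤c))
... | no k≰c with m≤n⇒∃[o]m+o≡n k≤q
... | d , refl =
  ℤ.≤-trans (ℤ.i⊓j≤j _ _) (f-mono p q α β slope≡c (k + d) k (rightEnd-≤ β d (≰⇒> k≰c)))
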